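{- Let $p:\mathrm{GF}(2)^n\to\mathrm{GF}(2)$ be a Boolean function and $i\ne j$ indices such that $x_ix_j$ is a term of the algebraic normal form of $p$ and no other term of $p$ is divisible by $x_ix_j$. Write $p=x_ix_j+x_i\mathcal N_i+x_j\mathcal N_j+R$ with $\mathcal N_i,\mathcal N_j,R$ Boolean functions not depending on $x_i$ or $x_j$, and let $p_{iji}=x_ix_j+x_i\mathcal N_j+x_j\mathcal N_i+\mathcal N_i\mathcal N_j+R$ (the pivot of $p$ on $ij$). Then $$(-1)^{p_{iji}}=(H_i\cdot H_j)(-1)^{p}.$$ In particular, every (hyper)graph function obtained from $p$ by pivoting is, as a bipolar vector, the image of $(-1)^p$ under some transform in $\{I,H\}^n$.
   Context: For a Boolean function $q$ on $\mathrm{GF}(2)^n$, $(-1)^q\in\mathbb C^{2^n}$ is the vector with entries $(-1)^{q(x)}$, $x\in\mathrm{GF}(2)^n$. $H=\frac1{\sqrt2}\begin{pmatrix}1&1\\1&-1\end{pmatrix}$, $I$ is the $2\times2$ identity, and $H_k$ denotes the tensor product of $n$ factors equal to $I$ except $H$ in the factor corresponding to variable $x_k$. $\{I,H\}^n$ is the set of all $n$-fold tensor products of matrices from $\{I,H\}$. A term of $p$ is a monomial in its algebraic normal form. -}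

module Defs where

open import Data.Bool using (Bool; true; false; _xor_; _∧_; _∨_; if_then_else_)
open import Data.Vec using (Vec; []; _∷_; lookup; tabulate; _[_]≔_)
open import Data.Fin using (Fin; _≟_)
open import Data.Integer using (ℤ; _+_; _*_; +_; -[1+_])
open import Relation.Nullary.Decidable using (⌊_⌋)
open import Relation.Binary.PropositionalEquality using (_≡_)

Point : (n : _) → Set
Point n = Vec Bool n

BoolFun : (n : _) → Set
BoolFun n = Point n → Bool

var : ∀ {n} → Fin n → BoolFun n
var k x = lookup x k

Indep : ∀ {n} → BoolFun n → Fin n → Set
Indep f k = ∀ x b → f (x [ k ]≔ b) ≡ f x

sign : Bool → ℤ
sign false = + 1
sign true  = -[1+ 0 ]

bipolar : ∀ {n} → BoolFun n → Point n → ℤ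
bipolar q x = sign (q x)

-- Unnormalised Hadamard on factor k:  Ĥ_k = √2 · H_k, acting on vectors indexed by points.
-- (Ĥ_k v)(x) = Σ_{b} (-1)^{x_k b} v(x[k≔b]).
Hhat : ∀ {n} → Fin n → (Point n → ℤ) → Point n → ℤ
Hhat k v x = v (x [ k ]≔ false) + sign (lookup x k) * v (x [ k ]≔ true)

-- Algebraic normal form: anf f S = coefficient of the monomial Π_{k ∈ S} x_k
-- (Möbius transform: ⊕_{x ⊆ S} f x).  Monomials are indexed by Vec Bool n.
anf : ∀ {n} → BoolFun n → Vec Bool n → Bool
anf {_} f [] = f []
anf {_} f (false ∷ s) = anf (λ v → f (false ∷ v)) s
anf {_} f (true ∷ s) = anf (λ v → f (false ∷ v)) s xor anf (λ v → f (true ∷ v)) s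

pairMon : ∀ {n} → Fin n → Fin n → Vec Bool n
pairMon i j = tabulate (λ k → ⌊ k ≟ i ⌋ ∨ ⌊ k ≟ j ⌋)

pivot : ∀ {n} → Fin n → Fin n → BoolFun n → BoolFun n → BoolFun n → BoolFun n
pivot i j Ni Nj R x =
  (var i x ∧ var j x) xor (var i x ∧ Nj x) xor (var j x ∧ Ni x) xor (Ni x ∧ Nj x) xor R x

-- Only the restriction of p to the (x_i, x_j)-plane matters: there p is the quadratic form
-- b a ⊕ b N_i ⊕ a N_j ⊕ R with N_i, N_j, R constant, and the two Hadamards compute its
-- two-bit Walsh transform.  Up to the factor 2 = (√2)², that transform is (-1) to the pivot,
-- a finite identity in the five bits x_i, x_j, N_i, N_j, R.
module Submission where

open import Defs
open import Data.Bool using (Bool; true; false; _xor_; _∧_)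
open import Data.Vec using (Vec; lookup; _[_]≔_)
open import Data.Vec.Properties using (lookup∘update; lookup∘update′)
open import Data.Fin using (Fin)
open import Data.Nat using (ℕ)
open import Data.Integer using (ℤ; _*_; +_; _+_)
open import Relation.Binary.PropositionalEquality using (_≡_; _≢_; refl; sym; cong; cong₂)
open Relation.Binary.PropositionalEquality.≡-Reasoning

quadraticPart : (b a ni nj r : Bool) → Bool
quadraticPart b a ni nj r = (b ∧ a) xor (b ∧ ni) xor (a ∧ nj) xor r

pivotPart : (b a ni nj r : Bool) → Bool
pivotPart b a ni nj r = (b ∧ a) xor (b ∧ nj) xor (a ∧ ni) xor (ni ∧ nj) xor r

walsh₂ : (Bool → Bool → ℤ) → Bool → Bool → ℤ
walsh₂ f xi xj = (f false false + sign xj * f false true)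
               + sign xi * (f true false + sign xj * f true true)

walsh₂-cong : ∀ {f g : Bool → Bool → ℤ} → (∀ b a → f b a ≡ g b a) →
  ∀ xi xj → walsh₂ f xi xj ≡ walsh₂ g xi xj
walsh₂-cong f≗g xi xj =
  cong₂ _+_ (cong₂ _+_ (f≗g false false) (cong (sign xj *_) (f≗g false true)))
            (cong (sign xi *_) (cong₂ _+_ (f≗g true false) (cong (sign xj *_) (f≗g true true))))

walsh₂-quadraticPart : ∀ xi xj ni nj r →
  (+ 2) * sign (pivotPart xi xj ni nj r) ≡
  walsh₂ (λ b a → sign (quadraticPart b a ni nj r)) xi xj
walsh₂-quadraticPart false false false false false = refl
walsh₂-quadraticPart false false false false true  = refl
walsh₂-quadraticPart false false false true  false = refl
walsh₂-quadraticPart false false false true  true  = refl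
walsh₂-quadraticPart false false true  false false = refl
walsh₂-quadraticPart false false true  false true  = refl
walsh₂-quadraticPart false false true  true  false = refl
walsh₂-quadraticPart false false true  true  true  = refl
walsh₂-quadraticPart false true  false false false = refl
walsh₂-quadraticPart false true  false false true  = refl
walsh₂-quadraticPart false true  false true  false = refl
walsh₂-quadraticPart false true  false true  true  = refl
walsh₂-quadraticPart false true  true  false false = refl
walsh₂-quadraticPart false true  true  false true  = refl
walsh₂-quadraticPart false true  true  true  false = refl
walsh₂-quadraticPart false true  true  true  true  = refl
walsh₂-quadraticPart true  false false false false = refl
walsh₂-quadraticPart true  false false false true  = refl
walsh₂-quadraticPart true  false false true  false = refl
walsh₂-quadraticPart true  false false true  true  = refl
walsh₂-quadraticPart true  false true  false false = refl
walsh₂-quadraticPart true  false true  false true  = refl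
walsh₂-quadraticPart true  false true  true  false = refl
walsh₂-quadraticPart true  false true  true  true  = refl
walsh₂-quadraticPart true  true  false false false = refl
walsh₂-quadraticPart true  true  false false true  = refl
walsh₂-quadraticPart true  true  false true  false = refl
walsh₂-quadraticPart true  true  false true  true  = refl
walsh₂-quadraticPart true  true  true  false false = refl
walsh₂-quadraticPart true  true  true  false true  = refl
walsh₂-quadraticPart true  true  true  true  false = refl
walsh₂-quadraticPart true  true  true  true  true  = refl

module _ {n : ℕ} {i j : Fin n} (i≢j : i ≢ j) where

  update₂ : Point n → Bool → Bool → Point n
  update₂ x b a = (x [ i ]≔ b) [ j ]≔ a

  var-i-update₂ : ∀ x b a → var i (update₂ x b a) ≡ b
  var-i-update₂ x b a = begin
    lookup ((x [ i ]≔ b) [ j ]≔ a) i  ≡⟨ lookup∘update′ i≢j (x [ i ]≔ b) a ⟩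
    lookup (x [ i ]≔ b) i             ≡⟨ lookup∘update i x b ⟩
    b                                 ∎

  var-j-update₂ : ∀ x b a → var j (update₂ x b a) ≡ a
  var-j-update₂ x b a = lookup∘update j (x [ i ]≔ b) a

  Indep-update₂ : ∀ {f : BoolFun n} → Indep f i → Indep f j → ∀ x b a → f (update₂ x b a) ≡ f x
  Indep-update₂ {f} fi fj x b a = begin
    f ((x [ i ]≔ b) [ j ]≔ a)  ≡⟨ fj (x [ i ]≔ b) a ⟩
    f (x [ i ]≔ b)             ≡⟨ fi x b ⟩
    f x                        ∎

  Hhat-Hhat≡walsh₂ : ∀ (v : Point n → ℤ) x →
    Hhat i (Hhat j v) x ≡ walsh₂ (λ b a → v (update₂ x b a)) (var i x) (var j x)
  Hhat-Hhat≡walsh₂ v x = cong₂ (λ sf st → inner false sf + sign (var i x) * inner true st)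
    (lookup∘update′ j≢i x false) (lookup∘update′ j≢i x true)
    where
    j≢i : j ≢ i
    j≢i j≡i = i≢j (sym j≡i)

    inner : Bool → Bool → ℤ
    inner b s = v (update₂ x b false) + sign s * v (update₂ x b true)

  restrict-quadraticForm : ∀ {p Ni Nj R : BoolFun n} →
    Indep Ni i → Indep Ni j → Indep Nj i → Indep Nj j → Indep R i → Indep R j →
    (∀ x → p x ≡ quadraticPart (var i x) (var j x) (Ni x) (Nj x) (R x)) →
    ∀ x b a → p (update₂ x b a) ≡ quadraticPart b a (Ni x) (Nj x) (R x)
  restrict-quadraticForm {p} {Ni} {Nj} {R} Nii Nij Nji Njj Ri Rj hp x b a = begin
    p y                                                  ≡⟨ hp y ⟩
    quadraticPart (var i y) (var j y) (Ni y) (Nj y) (R y)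
      ≡⟨ cong₂ (λ b′ a′ → quadraticPart b′ a′ (Ni y) (Nj y) (R y))
               (var-i-update₂ x b a) (var-j-update₂ x b a) ⟩
    quadraticPart b a (Ni y) (Nj y) (R y)
      ≡⟨ cong₂ (λ ni nj → quadraticPart b a ni nj (R y))
               (Indep-update₂ Nii Nij x b a) (Indep-update₂ Nji Njj x b a) ⟩
    quadraticPart b a (Ni x) (Nj x) (R y)                ≡⟨ cong (quadraticPart b a (Ni x) (Nj x))
                                                                  (Indep-update₂ Ri Rj x b a) ⟩
    quadraticPart b a (Ni x) (Nj x) (R x)                ∎
    where
    y : Point n
    y = update₂ x b a

theorem4 : (n : ℕ) (p : BoolFun n) (i j : Fin n) → i ≢ j →
    anf p (pairMon i j) ≡ true →
    (∀ (S : Vec Bool n) → lookup S i ≡ true → lookup S j ≡ true → S ≢ pairMon i j → anf p S ≡ false) →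
    (Ni Nj R : BoolFun n) →
    Indep Ni i → Indep Ni j → Indep Nj i → Indep Nj j → Indep R i → Indep R j →
    (∀ x → p x ≡ ((var i x ∧ var j x) xor (var i x ∧ Ni x) xor (var j x ∧ Nj x) xor R x)) →
    ∀ (x : Point n) → (+ 2) * bipolar (pivot i j Ni Nj R) x ≡ Hhat i (Hhat j (bipolar p)) x
-- The ANF hypotheses only guarantee that the decomposition of p exists; it is supplied explicitly.
theorem4 n p i j i≢j _ _ Ni Nj R Nii Nij Nji Njj Ri Rj hp x = begin
  (+ 2) * sign (pivotPart (var i x) (var j x) (Ni x) (Nj x) (R x))
    ≡⟨ walsh₂-quadraticPart (var i x) (var j x) (Ni x) (Nj x) (R x) ⟩
  walsh₂ (λ b a → sign (quadraticPart b a (Ni x) (Nj x) (R x))) (var i x) (var j x)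
    ≡⟨ walsh₂-cong (λ b a → cong sign (sym (restrict-quadraticForm i≢j Nii Nij Nji Njj Ri Rj hp x b a)))
                   (var i x) (var j x) ⟩
  walsh₂ (λ b a → bipolar p (update₂ i≢j x b a)) (var i x) (var j x)
    ≡⟨ sym (Hhat-Hhat≡walsh₂ i≢j (bipolar p) x) ⟩
  Hhat i (Hhat j (bipolar p)) x ∎
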